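{- Let $G=(V,E)$ be a connected bipartite graph of order $n=r+s\ge 4$ with stable sets (bipartition classes) $U$ and $W$, $V=U\cup W$, where $|U|=r$, $|W|=s$ and $3\le r<s$. Then $\lambda(\overline{G})=\lambda(G)+1$ if and only if the following three conditions hold: (i) $W$ contains no pair of twins; (ii) there exists a vertex $w\in W$ such that $N(w)=U$; (iii) for every vertex $u\in U$, the edge-labeled graph $G^U$ has at least two edges with label $u$.
   Context: All graphs are simple and finite. $N(x)$ denotes the (open) neighborhood of $x$ in $G$. A set $S\subseteq V$ is distinguishing if $N(x)\cap S\neq N(y)\cap S$ for every pair of distinct vertices $x,y\in V\setminus S$; it is dominating if every vertex not in $S$ has a neighbor in $S$; a locating-dominating set (LD-set) is a set that is both distinguishing and dominating. $\lambda(G)$, the location-domination number, is the minimum cardinality of an LD-set of $G$. $\overline{G}$ is the complement of $G$. Two distinct vertices $x,y$ are twins if $N(x)=N(y)$ or $N(x)\cup\{x\}=N(y)\cup\{y\}$. For $S\subseteq V$, the $S$-associated graph $G^S$ is the edge-labeled graph with vertex set $V\setminus S$, where $x,y\in V\setminus S$ are adjacent iff the sets $N(x)\cap S$ and $N(y)\cap S$ differ in exactly one vertex $u\in S$ (i.e., their symmetric difference is $\{u\}$), and then the edge $xy$ receives label $\ell(xy)=u$. (In the paper $G^S$ is considered for distinguishing sets $S$; condition (i) is equivalent to $U$ being distinguishing.) -}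

module Defs where

open import Data.Nat using (ℕ; _≤_; _<_; _+_)
open import Data.Fin using (Fin)
open import Data.Fin.Properties using (_≟_)
open import Data.Fin.Subset using (Subset; _∈_; _∉_; ∣_∣; ∁)
open import Data.Bool using (Bool; true; false; not; _∧_; _∨_)
open import Data.Product using (Σ; ∃; _×_; _,_)
open import Data.Sum using (_⊎_)
open import Relation.Nullary using (¬_)
open import Relation.Nullary.Decidable using (⌊_⌋)
open import Relation.Binary.PropositionalEquality using (_≡_; _≢_)
open import Function.Bundles using (_⇔_)

record Graph (n : ℕ) : Set where
  field
    adj   : Fin n → Fin n → Bool
    sym   : ∀ x y → adj x y ≡ adj y x
    irrefl : ∀ x → adj x x ≡ false
open Graph public

module _ {n : ℕ} where

  complement : Graph n → Graph n
  complement G = record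
    { adj = λ x y → not (adj G x y) ∧ not ⌊ x ≟ y ⌋
    ; sym = symc
    ; irrefl = irc }
    where
      open import Relation.Binary.PropositionalEquality using (refl; cong₂; cong; sym)
      open import Relation.Nullary using (yes; no)
      import Relation.Binary.PropositionalEquality as P
      eqsym : ∀ x y → ⌊ x ≟ y ⌋ ≡ ⌊ y ≟ x ⌋
      eqsym x y with x ≟ y | y ≟ x
      ... | yes _ | yes _ = refl
      ... | no _  | no _  = refl
      ... | yes p | no q  = Data.Empty.⊥-elim (q (P.sym p))
        where import Data.Empty
      ... | no p  | yes q = Data.Empty.⊥-elim (p (P.sym q))
        where import Data.Empty
      symc : ∀ x y → (not (adj G x y) ∧ not ⌊ x ≟ y ⌋) ≡ (not (adj G y x) ∧ not ⌊ y ≟ x ⌋)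
      symc x y = cong₂ (λ a b → not a ∧ not b) (Graph.sym G x y) (eqsym x y)
      irc : ∀ x → (not (adj G x x) ∧ not ⌊ x ≟ x ⌋) ≡ false
      irc x with x ≟ x
      ... | yes _ = Data.Bool.Properties.∧-zeroʳ (not (adj G x x))
        where import Data.Bool.Properties
      ... | no q = Data.Empty.⊥-elim (q refl)
        where import Data.Empty

  SameTrace : Graph n → Subset n → Fin n → Fin n → Set
  SameTrace G S x y = ∀ z → z ∈ S → adj G x z ≡ adj G y z

  Distinguishing : Graph n → Subset n → Set
  Distinguishing G S = ∀ x y → x ∉ S → y ∉ S → x ≢ y → ¬ SameTrace G S x y

  Dominating : Graph n → Subset n → Set
  Dominating G S = ∀ x → x ∉ S → ∃ λ z → z ∈ S × adj G x z ≡ true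

  IsLDSet : Graph n → Subset n → Set
  IsLDSet G S = Distinguishing G S × Dominating G S

  IsLocDomNumber : Graph n → ℕ → Set
  IsLocDomNumber G k =
    (∃ λ S → IsLDSet G S × ∣ S ∣ ≡ k) × (∀ S → IsLDSet G S → k ≤ ∣ S ∣)

  data Reach (G : Graph n) : Fin n → Fin n → Set where
    here : ∀ {x} → Reach G x x
    step : ∀ {x y z} → adj G x y ≡ true → Reach G y z → Reach G x z

  Connected : Graph n → Set
  Connected G = ∀ x y → Reach G x y

  Stable : Graph n → Subset n → Set
  Stable G S = ∀ x y → x ∈ S → y ∈ S → adj G x y ≡ false

  closedAdj : Graph n → Fin n → Fin n → Bool
  closedAdj G x z = adj G x z ∨ ⌊ x ≟ z ⌋

  Twins : Graph n → Fin n → Fin n → Set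
  Twins G x y = x ≢ y ×
    ((∀ z → adj G x z ≡ adj G y z) ⊎ (∀ z → closedAdj G x z ≡ closedAdj G y z))

  -- xy is an edge of the S-associated graph G^S with label u:
  -- the symmetric difference of N(x) ∩ S and N(y) ∩ S is exactly {u}
  -- (x, y ∉ S).
  LabeledEdge : Graph n → Subset n → Fin n → Fin n → Fin n → Set
  LabeledEdge G S u x y =
    x ∉ S × y ∉ S × u ∈ S × adj G x u ≢ adj G y u ×
    (∀ v → v ∈ S → v ≢ u → adj G x v ≡ adj G y v)

  TwoEdgesWithLabel : Graph n → Subset n → Fin n → Set
  TwoEdgesWithLabel G S u = Σ (Fin n) λ x → Σ (Fin n) λ y → Σ (Fin n) λ x' → Σ (Fin n) λ y' →
    LabeledEdge G S u x y × LabeledEdge G S u x' y' ×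
    ¬ ((x ≡ x' × y ≡ y') ⊎ (x ≡ y' × y ≡ x'))

-- Distinguishing sets of G and of its complement coincide, and a distinguishing set S of G
-- dominates the complement unless some vertex is adjacent in G to all of S.  Hence
-- λ(Ḡ) ≤ λ(G) + 1, and λ(Ḡ) > λ(G) says that every distinguishing set of size at most λ(G)
-- has a common neighbour.  In a connected bipartite graph an optimal LD-set with a common
-- neighbour is a whole side.  Trace counting excludes the side W: if every w ∈ W labels an
-- edge of G^W with ends in U, then the vertices of U have at least |W| + 1 distinct traces on W,
-- impossible as r < s.  So U is an optimal LD-set, which gives (i) and (ii); and (iii) holds
-- because trading u ∈ U for a neighbour w leaves a distinguishing set without common neighbour
-- unless G^U has an edge labelled u avoiding w.  Conversely, under (i)-(iii) the same counting
-- shows that a distinguishing set of size at most |U| is U itself, and the vertex of (ii) is a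
-- common neighbour of U, so no LD-set of Ḡ has size at most λ(G).
module Submission where

open import Defs hiding (sym)
open import Data.Bool using (true; false; not)
open import Data.Bool.Properties
  using (not-involutive; not-injective; ¬-not; ∧-identityʳ; ∨-identityʳ; ∨-zeroʳ)
  renaming (_≟_ to _≟ᵇ_)
open import Data.Empty using (⊥; ⊥-elim)
open import Data.Fin using (Fin)
open import Data.Fin.Properties using (_≟_; any?; all?; ¬∀⟶∃¬)
open import Data.Fin.Subset
  using (Subset; inside; outside; ⊤; _∈_; _∉_; _⊆_; ∣_∣; ∁; _∪_; _∩_; _─_; _-_; ⁅_⁆; Nonempty)
  renaming (⊥ to ∅)
open import Data.Fin.Subset.Properties
  using (_∈?_; nonempty?; Empty-unique; ⊆-antisym; ⊥⊆; p⊆p∪q; p─q⊆p;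
         x∈p∪q⁺; x∈p∪q⁻; x∈p∩q⁺; x∈p∩q⁻; x∈p∧x∉q⇒x∈p─q; x∈p∧x≢y⇒x∈p-y;
         x∈⁅x⁆; x∈⁅y⁆⇒x≡y; x∉⁅y⁆⇒x≢y; x∈∁p⇒x∉p; x∈p⇒x∉∁p; x∉p⇒x∈∁p; x∉∁p⇒x∈p;
         p─⊥≡p; p─q─r≡p─q∪r;
         ∣p∣≤n; ∣⊤∣≡n; ∣⊥∣≡0; ∣⁅x⁆∣≡1; ∣∁p∣≡n∸∣p∣; ∣p∣≤∣x∷p∣;
         p⊆q⇒∣p∣≤∣q∣; p⊂q⇒∣p∣<∣q∣; x∈p⇒∣p-x∣<∣p∣)
open import Data.Nat using (ℕ; zero; suc; _≤_; _<_; _+_; z≤n; s≤s; _<?_)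
open import Data.Nat.Properties
  using (≤-refl; ≤-reflexive; ≤-trans; ≤-antisym; ≤-pred; ≤-<-trans; <-trans; <-irrefl; <-asym;
         <⇒≢; <⇒≱; ≮⇒≥; +-comm; +-suc; +-identityʳ; +-monoʳ-≤; +-monoˡ-≤; +-cancelˡ-≤; +-cancelʳ-≤;
         m≤m+n; m+[n∸m]≡n; module ≤-Reasoning)
open import Data.Product using (∃; ∃₂; _×_; _,_; proj₂)
open import Data.Sum using (_⊎_; inj₁; inj₂)
open import Data.Vec.Base using ([]; _∷_; here; there)
open import Function.Base using (_∘_)
open import Function.Bundles using (_⇔_; mk⇔; Equivalence)
open import Relation.Binary.PropositionalEquality
  using (_≡_; _≢_; refl; sym; trans; cong; cong₂; subst; module ≡-Reasoning)
open import Relation.Nullary using (¬_; Dec; yes; no)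
open import Relation.Nullary.Decidable using (_×-dec_; _→-dec_; ¬?)

∣p∪q∣≤∣p∣+∣q∣ : ∀ {n} (p q : Subset n) → ∣ p ∪ q ∣ ≤ ∣ p ∣ + ∣ q ∣
∣p∪q∣≤∣p∣+∣q∣ []            []            = z≤n
∣p∪q∣≤∣p∣+∣q∣ (inside  ∷ p) (b       ∷ q) =
  s≤s (≤-trans (∣p∪q∣≤∣p∣+∣q∣ p q) (+-monoʳ-≤ ∣ p ∣ (∣p∣≤∣x∷p∣ b q)))
∣p∪q∣≤∣p∣+∣q∣ (outside ∷ p) (outside ∷ q) = ∣p∪q∣≤∣p∣+∣q∣ p q
∣p∪q∣≤∣p∣+∣q∣ (outside ∷ p) (inside  ∷ q) =
  ≤-trans (s≤s (∣p∪q∣≤∣p∣+∣q∣ p q)) (≤-reflexive (sym (+-suc ∣ p ∣ ∣ q ∣)))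

x∈p─q⇒x∉q : ∀ {n} {p q : Subset n} {x} → x ∈ p ─ q → x ∉ q
x∈p─q⇒x∉q {p = _ ∷ _} {q = inside ∷ _} () here
x∈p─q⇒x∉q {p = _ ∷ _} {q = _      ∷ _} (there x∈p─q) (there x∈q) = x∈p─q⇒x∉q x∈p─q x∈q

∁∁p≡p : ∀ {n} (p : Subset n) → ∁ (∁ p) ≡ p
∁∁p≡p []      = refl
∁∁p≡p (b ∷ p) = cong₂ _∷_ (not-involutive b) (∁∁p≡p p)

module _ {n : ℕ} where

  private
    variable
      p q S X Z P Q : Subset n
      a b c d u v w x y y′ z x₀ : Fin n
      k l : ℕ

  x∉p∧y∈p⇒x≢y : x ∉ p → y ∈ p → x ≢ y
  x∉p∧y∈p⇒x≢y x∉p y∈p refl = x∉p y∈p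

  x∈p-y⇒x≢y : x ∈ p - y → x ≢ y
  x∈p-y⇒x≢y x∈p-y = x∉⁅y⁆⇒x≢y (x∈p─q⇒x∉q x∈p-y)

  x∈p⇒⁅x⁆⊆p : x ∈ p → ⁅ x ⁆ ⊆ p
  x∈p⇒⁅x⁆⊆p {x = x} x∈p v∈⁅x⁆ = subst (_∈ _) (sym (x∈⁅y⁆⇒x≡y x v∈⁅x⁆)) x∈p

  ∪⁅⁆⊆ : p ⊆ q → x ∈ q → p ∪ ⁅ x ⁆ ⊆ q
  ∪⁅⁆⊆ {p = p} {x = x} p⊆q x∈q v∈ with x∈p∪q⁻ p ⁅ x ⁆ v∈
  ... | inj₁ v∈p   = p⊆q v∈p
  ... | inj₂ v∈⁅x⁆ = x∈p⇒⁅x⁆⊆p x∈q v∈⁅x⁆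

  x∈p⇒0<∣p∣ : x ∈ p → 0 < ∣ p ∣
  x∈p⇒0<∣p∣ x∈p = ≤-<-trans z≤n (x∈p⇒∣p-x∣<∣p∣ x∈p)

  0<∣p∣⇒Nonempty : 0 < ∣ p ∣ → Nonempty p
  0<∣p∣⇒Nonempty {p = p} 0<∣p∣ with nonempty? p
  ... | yes ne    = ne
  ... | no  empty = ⊥-elim (<⇒≢ 0<∣p∣ (sym (trans (cong ∣_∣ (Empty-unique empty)) (∣⊥∣≡0 n))))

  ∣p∣≤∣p─q∣+∣q∣ : ∀ (p q : Subset n) → ∣ p ∣ ≤ ∣ p ─ q ∣ + ∣ q ∣
  ∣p∣≤∣p─q∣+∣q∣ p q = ≤-trans (p⊆q⇒∣p∣≤∣q∣ cover) (∣p∪q∣≤∣p∣+∣q∣ (p ─ q) q)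
    where
    cover : p ⊆ (p ─ q) ∪ q
    cover {x} x∈p with x ∈? q
    ... | yes x∈q = x∈p∪q⁺ (inj₂ x∈q)
    ... | no  x∉q = x∈p∪q⁺ (inj₁ (x∈p∧x∉q⇒x∈p─q x∈p x∉q))

  ∣p∣+∣∁p∣≡n : ∀ (p : Subset n) → ∣ p ∣ + ∣ ∁ p ∣ ≡ n
  ∣p∣+∣∁p∣≡n p = trans (cong (∣ p ∣ +_) (∣∁p∣≡n∸∣p∣ p)) (m+[n∸m]≡n (∣p∣≤n p))

  x∉p⇒∣p∣<∣p∪⁅x⁆∣ : x ∉ p → ∣ p ∣ < ∣ p ∪ ⁅ x ⁆ ∣
  x∉p⇒∣p∣<∣p∪⁅x⁆∣ {x = x} x∉p = p⊂q⇒∣p∣<∣q∣ (p⊆p∪q ⁅ x ⁆ , x , x∈p∪q⁺ (inj₂ (x∈⁅x⁆ x)) , x∉p)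

  1<∣p∣⇒Nonempty[p-x] : 1 < ∣ p ∣ → Nonempty (p - x)
  1<∣p∣⇒Nonempty[p-x] {p = p} {x = x} 1<∣p∣ = 0<∣p∣⇒Nonempty (+-cancelʳ-≤ 1 1 ∣ p - x ∣ 2≤∣p-x∣+1)
    where
    2≤∣p-x∣+1 : 2 ≤ ∣ p - x ∣ + 1
    2≤∣p-x∣+1 = ≤-trans 1<∣p∣
      (≤-trans (∣p∣≤∣p─q∣+∣q∣ p ⁅ x ⁆) (≤-reflexive (cong (∣ p - x ∣ +_) (∣⁅x⁆∣≡1 x))))

  ∣p∣+2≤∣q∣ : p ⊆ q → x ∈ q → y ∈ q → x ∉ p → y ∉ p → x ≢ y → ∣ p ∣ + 2 ≤ ∣ q ∣
  ∣p∣+2≤∣q∣ {p = p} {q = q} {x = x} {y = y} p⊆q x∈q y∈q x∉p y∉p x≢y = begin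
    ∣ p ∣ + 2                  ≡⟨ +-comm ∣ p ∣ 2 ⟩
    suc (suc ∣ p ∣)            ≤⟨ s≤s (x∉p⇒∣p∣<∣p∪⁅x⁆∣ x∉p) ⟩
    suc ∣ p ∪ ⁅ x ⁆ ∣          ≤⟨ x∉p⇒∣p∣<∣p∪⁅x⁆∣ y∉p∪⁅x⁆ ⟩
    ∣ (p ∪ ⁅ x ⁆) ∪ ⁅ y ⁆ ∣    ≤⟨ p⊆q⇒∣p∣≤∣q∣ (∪⁅⁆⊆ (∪⁅⁆⊆ p⊆q x∈q) y∈q) ⟩
    ∣ q ∣                      ∎
    where
    open ≤-Reasoning
    y∉p∪⁅x⁆ : y ∉ p ∪ ⁅ x ⁆
    y∉p∪⁅x⁆ y∈ with x∈p∪q⁻ p ⁅ x ⁆ y∈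
    ... | inj₁ y∈p   = y∉p y∈p
    ... | inj₂ y∈⁅x⁆ = x≢y (sym (x∈⁅y⁆⇒x≡y x y∈⁅x⁆))

  ∣p─q∣≤1+∣p─[q∪⁅x⁆]∣ : ∀ (p q : Subset n) x → ∣ p ─ q ∣ ≤ suc ∣ p ─ (q ∪ ⁅ x ⁆) ∣
  ∣p─q∣≤1+∣p─[q∪⁅x⁆]∣ p q x = begin
    ∣ p ─ q ∣                        ≤⟨ ∣p∣≤∣p─q∣+∣q∣ (p ─ q) ⁅ x ⁆ ⟩
    ∣ p ─ q ─ ⁅ x ⁆ ∣ + ∣ ⁅ x ⁆ ∣    ≡⟨ cong₂ (λ r k → ∣ r ∣ + k) (p─q─r≡p─q∪r p q ⁅ x ⁆) (∣⁅x⁆∣≡1 x) ⟩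
    ∣ p ─ (q ∪ ⁅ x ⁆) ∣ + 1          ≡⟨ +-comm ∣ p ─ (q ∪ ⁅ x ⁆) ∣ 1 ⟩
    suc ∣ p ─ (q ∪ ⁅ x ⁆) ∣          ∎
    where open ≤-Reasoning

  x∈p─q⇒∣p─[q∪⁅x⁆]∣<∣p─q∣ : x ∈ p ─ q → ∣ p ─ (q ∪ ⁅ x ⁆) ∣ < ∣ p ─ q ∣
  x∈p─q⇒∣p─[q∪⁅x⁆]∣<∣p─q∣ {x = x} {p = p} {q = q} x∈p─q =
    subst (λ r → ∣ r ∣ < ∣ p ─ q ∣) (p─q─r≡p─q∪r p q ⁅ x ⁆) (x∈p⇒∣p-x∣<∣p∣ x∈p─q)

  ∣p─q∣≤1+∣[p-x]─[p∩q]∣ : ∀ (p q : Subset n) x → ∣ p ─ q ∣ ≤ suc ∣ (p - x) ─ (p ∩ q) ∣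
  ∣p─q∣≤1+∣[p-x]─[p∩q]∣ p q x = begin
    ∣ p ─ q ∣                                  ≤⟨ p⊆q⇒∣p∣≤∣q∣ cover ⟩
    ∣ ((p - x) ─ (p ∩ q)) ∪ ⁅ x ⁆ ∣            ≤⟨ ∣p∪q∣≤∣p∣+∣q∣ ((p - x) ─ (p ∩ q)) ⁅ x ⁆ ⟩
    ∣ (p - x) ─ (p ∩ q) ∣ + ∣ ⁅ x ⁆ ∣          ≡⟨ cong (∣ (p - x) ─ (p ∩ q) ∣ +_) (∣⁅x⁆∣≡1 x) ⟩
    ∣ (p - x) ─ (p ∩ q) ∣ + 1                  ≡⟨ +-comm ∣ (p - x) ─ (p ∩ q) ∣ 1 ⟩
    suc ∣ (p - x) ─ (p ∩ q) ∣                  ∎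
    where
    open ≤-Reasoning
    cover : p ─ q ⊆ ((p - x) ─ (p ∩ q)) ∪ ⁅ x ⁆
    cover {y} y∈p─q with y ≟ x
    ... | yes refl = x∈p∪q⁺ (inj₂ (x∈⁅x⁆ y))
    ... | no  y≢x  = x∈p∪q⁺ (inj₁ (x∈p∧x∉q⇒x∈p─q (x∈p∧x≢y⇒x∈p-y (p─q⊆p p q y∈p─q) y≢x) y∉p∩q))
      where
      y∉p∩q : y ∉ p ∩ q
      y∉p∩q y∈p∩q = x∈p─q⇒x∉q y∈p─q (proj₂ (x∈p∩q⁻ p q y∈p∩q))

  n≤∣p∣+∣q─p∣+∣∁q─p∣ : ∀ (p q : Subset n) → n ≤ ∣ p ∣ + (∣ q ─ p ∣ + ∣ ∁ q ─ p ∣)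
  n≤∣p∣+∣q─p∣+∣∁q─p∣ p q = begin
    n                                   ≡⟨ sym (∣⊤∣≡n n) ⟩
    ∣ ⊤ {n} ∣                           ≤⟨ ∣p∣≤∣p─q∣+∣q∣ ⊤ p ⟩
    ∣ ⊤ ─ p ∣ + ∣ p ∣                   ≤⟨ +-monoˡ-≤ ∣ p ∣ (p⊆q⇒∣p∣≤∣q∣ cover) ⟩
    ∣ (q ─ p) ∪ (∁ q ─ p) ∣ + ∣ p ∣     ≤⟨ +-monoˡ-≤ ∣ p ∣ (∣p∪q∣≤∣p∣+∣q∣ (q ─ p) (∁ q ─ p)) ⟩
    ∣ q ─ p ∣ + ∣ ∁ q ─ p ∣ + ∣ p ∣     ≡⟨ +-comm (∣ q ─ p ∣ + ∣ ∁ q ─ p ∣) ∣ p ∣ ⟩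
    ∣ p ∣ + (∣ q ─ p ∣ + ∣ ∁ q ─ p ∣)   ∎
    where
    open ≤-Reasoning
    cover : ⊤ ─ p ⊆ (q ─ p) ∪ (∁ q ─ p)
    cover {x} x∈⊤─p with x ∈? q
    ... | yes x∈q = x∈p∪q⁺ (inj₁ (x∈p∧x∉q⇒x∈p─q x∈q (x∈p─q⇒x∉q x∈⊤─p)))
    ... | no  x∉q = x∈p∪q⁺ (inj₂ (x∈p∧x∉q⇒x∈p─q (x∉p⇒x∈∁p x∉q) (x∈p─q⇒x∉q x∈⊤─p)))

  module Traces (G : Graph n) where

    sameTrace-refl : SameTrace G S a a
    sameTrace-refl _ _ = refl

    sameTrace-sym : SameTrace G S a b → SameTrace G S b a
    sameTrace-sym a~b z z∈S = sym (a~b z z∈S)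

    sameTrace-trans : SameTrace G S a b → SameTrace G S b c → SameTrace G S a c
    sameTrace-trans a~b b~c z z∈S = trans (a~b z z∈S) (b~c z z∈S)

    sameTrace-⊆ : Z ⊆ S → SameTrace G S a b → SameTrace G Z a b
    sameTrace-⊆ Z⊆S a~b z z∈Z = a~b z (Z⊆S z∈Z)

    sameTrace? : ∀ S a b → Dec (SameTrace G S a b)
    sameTrace? S a b = all? (λ z → z ∈? S →-dec adj G a z ≟ᵇ adj G b z)

    labeledEdge-sym : LabeledEdge G S u a b → LabeledEdge G S u b a
    labeledEdge-sym (a∉S , b∉S , u∈S , a≁b , agree) =
      b∉S , a∉S , u∈S , (λ e → a≁b (sym e)) , λ v v∈S v≢u → sym (agree v v∈S v≢u)

    labeledEdge? : ∀ S u a b → Dec (LabeledEdge G S u a b)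
    labeledEdge? S u a b =
      ¬? (a ∈? S) ×-dec ¬? (b ∈? S) ×-dec u ∈? S ×-dec ¬? (adj G a u ≟ᵇ adj G b u) ×-dec
      all? (λ v → v ∈? S →-dec (¬? (v ≟ u) →-dec adj G a v ≟ᵇ adj G b v))

    distinguishing-⊆ : S ⊆ Z → Distinguishing G S → Distinguishing G Z
    distinguishing-⊆ S⊆Z dist a b a∉Z b∉Z a≢b a~b =
      dist a b (λ a∈S → a∉Z (S⊆Z a∈S)) (λ b∈S → b∉Z (S⊆Z b∈S)) a≢b (sameTrace-⊆ S⊆Z a~b)

    labeledEdge-⊆ : Z ⊆ Q → u ∈ Z → LabeledEdge G Q u a b → LabeledEdge G Z u a b
    labeledEdge-⊆ Z⊆Q u∈Z (a∉Q , b∉Q , _ , a≁b , agree) =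
      (λ a∈Z → a∉Q (Z⊆Q a∈Z)) , (λ b∈Z → b∉Q (Z⊆Q b∈Z)) , u∈Z , a≁b , λ v v∈Z → agree v (Z⊆Q v∈Z)

    labeledEdge-oriented : LabeledEdge G S u a b →
                           ∃₂ λ a′ b′ → LabeledEdge G S u a′ b′ × adj G a′ u ≡ true
    labeledEdge-oriented {u = u} {a = a} {b = b} e@(_ , _ , _ , a≁b , _) with adj G a u ≟ᵇ true
    ... | yes au  = a , b , e , au
    ... | no  ¬au =
      b , a , labeledEdge-sym e , trans (¬-not (λ ba → a≁b (sym ba))) (cong not (¬-not ¬au))

    twoEdgesWithLabel : (∀ {w} → w ∉ S → adj G w u ≡ true →
                           ∃₂ λ a b → LabeledEdge G S u a b × a ≢ w × b ≢ w) →
                        w ∉ S → adj G w u ≡ true → TwoEdgesWithLabel G S u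
    twoEdgesWithLabel avoid w∉S wu with avoid w∉S wu
    ... | _ , _ , e₀ , _ with labeledEdge-oriented e₀
    ...   | a , b , e@(a∉S , _) , au with avoid a∉S au
    ...     | c , d , e′ , c≢a , d≢a =
      a , b , c , d , e , e′ , λ { (inj₁ (a≡c , _)) → c≢a (sym a≡c) ; (inj₂ (a≡d , _)) → d≢a (sym a≡d) }

    Separates : Subset n → Subset n → Set
    Separates Z X = ∀ a b → a ∈ X → b ∈ X → a ≢ b → ¬ SameTrace G Z a b

    separates-⊆ : Z ⊆ Q → Separates Z X → Separates Q X
    separates-⊆ Z⊆Q sep a b a∈X b∈X a≢b a~b = sep a b a∈X b∈X a≢b (sameTrace-⊆ Z⊆Q a~b)

    separates-⁅⁆ : Separates Z ⁅ c ⁆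
    separates-⁅⁆ {c = c} a b a∈ b∈ a≢b _ = a≢b (trans (x∈⁅y⁆⇒x≡y c a∈) (sym (x∈⁅y⁆⇒x≡y c b∈)))

    separates-∪⁅⁆ : Separates Z X → (∀ a → a ∈ X → ¬ SameTrace G Z a c) → Separates Z (X ∪ ⁅ c ⁆)
    separates-∪⁅⁆ {Z = Z} {X = X} {c = c} sep new a b a∈ b∈ a≢b a~b
      with x∈p∪q⁻ X ⁅ c ⁆ a∈ | x∈p∪q⁻ X ⁅ c ⁆ b∈
    ... | inj₁ a∈X | inj₁ b∈X = sep a b a∈X b∈X a≢b a~b
    ... | inj₁ a∈X | inj₂ b∈⁅c⁆ = new a a∈X (subst (SameTrace G Z a) (x∈⁅y⁆⇒x≡y c b∈⁅c⁆) a~b)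
    ... | inj₂ a∈⁅c⁆ | inj₁ b∈X =
      new b b∈X (subst (SameTrace G Z b) (x∈⁅y⁆⇒x≡y c a∈⁅c⁆) (sameTrace-sym a~b))
    ... | inj₂ a∈⁅c⁆ | inj₂ b∈⁅c⁆ = separates-⁅⁆ a b a∈⁅c⁆ b∈⁅c⁆ a≢b a~b

    separates-missesEndpoint : Separates (Q - u) X → LabeledEdge G Q u a b →
                               ∃ λ x → (x ≡ a ⊎ x ≡ b) × x ∉ X
    separates-missesEndpoint {u = u} {X = X} {a = a} {b = b} sep (_ , _ , _ , a≁b , agree)
      with a ∈? X | b ∈? X
    ... | no  a∉X | _       = a , inj₁ refl , a∉X
    ... | yes _   | no  b∉X = b , inj₂ refl , b∉X
    ... | yes a∈X | yes b∈X = ⊥-elim (sep a b a∈X b∈X (λ a≡b → a≁b (cong (λ v → adj G v u) a≡b))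
                                        (λ z z∈Q-u → agree z (p─q⊆p _ _ z∈Q-u) (x∈p-y⇒x≢y z∈Q-u)))

    separates-fresh : Separates Z X → x₀ ∈ X → SameTrace G Z x₀ c → adj G x₀ u ≢ adj G c u →
                      c ∉ X × (∀ a → a ∈ X → ¬ SameTrace G (Z ∪ ⁅ u ⁆) a c)
    separates-fresh {Z = Z} {X = X} {x₀ = x₀} {c = c} {u = u} sep x₀∈X x₀~c x₀≁c = c∉X , new
      where
      c∉X : c ∉ X
      c∉X c∈X = sep x₀ c x₀∈X c∈X (λ x₀≡c → x₀≁c (cong (λ v → adj G v u) x₀≡c)) x₀~c
      new : ∀ a → a ∈ X → ¬ SameTrace G (Z ∪ ⁅ u ⁆) a c
      new a a∈X a~c with a ≟ x₀
      ... | yes refl = x₀≁c (a~c u (x∈p∪q⁺ (inj₂ (x∈⁅x⁆ u))))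
      ... | no  a≢x₀ =
        sep a x₀ a∈X x₀∈X a≢x₀ (sameTrace-trans (sameTrace-⊆ (p⊆p∪q ⁅ u ⁆) a~c) (sameTrace-sym x₀~c))

    separates-grow : a ∈ P → b ∈ P → Separates Z X → SameTrace G Z a b → adj G a u ≢ adj G b u →
                     ∃ λ c → c ∈ P × c ∉ X × (∀ x → x ∈ X → ¬ SameTrace G (Z ∪ ⁅ u ⁆) x c)
    separates-grow {a = a} {b = b} {Z = Z} {X = X} {u = u} a∈P b∈P sep a~b a≁b
      with any? (λ x → x ∈? X ×-dec sameTrace? Z x a)
    ... | no none =
      a , a∈P , (λ a∈X → none (a , a∈X , sameTrace-refl)) ,
      λ x x∈X x~a → none (x , x∈X , sameTrace-⊆ (p⊆p∪q ⁅ u ⁆) x~a)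
    ... | yes (x₀ , x₀∈X , x₀~a) with adj G x₀ u ≟ᵇ adj G a u
    ...   | no  x₀≁a = a , a∈P , separates-fresh sep x₀∈X x₀~a x₀≁a
    ...   | yes x₀≈a =
      b , b∈P , separates-fresh sep x₀∈X (sameTrace-trans x₀~a a~b)
                                (λ x₀≈b → a≁b (trans (sym x₀≈a) x₀≈b))

    LabeledEdgeIn : Subset n → Subset n → Fin n → Set
    LabeledEdgeIn Q P u = ∃₂ λ a b → a ∈ P × b ∈ P × LabeledEdge G Q u a b

    separates-addLabel : LabeledEdgeIn Q P u → u ∉ Z → Z ⊆ Q → X ⊆ P → Separates Z X →
                         ∃ λ X₁ → X₁ ⊆ P × Separates (Z ∪ ⁅ u ⁆) X₁ × ∣ X ∣ < ∣ X₁ ∣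
    separates-addLabel {Q = Q} {P = P} {u = u} {Z = Z} {X = X}
                       (a , b , a∈P , b∈P , _ , _ , _ , a≁b , agree) u∉Z Z⊆Q X⊆P sep
      with separates-grow a∈P b∈P sep a~b a≁b
      where
      a~b : SameTrace G Z a b
      a~b z z∈Z = agree z (Z⊆Q z∈Z) (λ z≡u → u∉Z (subst (_∈ Z) z≡u z∈Z))
    ... | c , c∈P , c∉X , new =
      X ∪ ⁅ c ⁆ , ∪⁅⁆⊆ X⊆P c∈P , separates-∪⁅⁆ (separates-⊆ (p⊆p∪q ⁅ u ⁆) sep) new , x∉p⇒∣p∣<∣p∪⁅x⁆∣ c∉X

    -- Each label u ∈ Q ─ Z splits a class of vertices of P with equal traces on Z, so a
    -- separated subset of P gains one vertex per label.
    separates-extend : (∀ u → u ∈ Q → LabeledEdgeIn Q P u) → ∀ m → Z ⊆ Q → ∣ Q ─ Z ∣ ≤ m → X ⊆ P →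
                       Separates Z X → ∃ λ X′ → X′ ⊆ P × Separates Q X′ × ∣ X ∣ + ∣ Q ─ Z ∣ ≤ ∣ X′ ∣
    separates-extend {Q = Q} {Z = Z} {X = X} edge m Z⊆Q ∣Q─Z∣≤m X⊆P sep with nonempty? (Q ─ Z)
    ... | no empty = X , X⊆P , separates-⊆ Z⊆Q sep , ≤-reflexive ∣X∣+∣Q─Z∣≡∣X∣
      where
      ∣X∣+∣Q─Z∣≡∣X∣ : ∣ X ∣ + ∣ Q ─ Z ∣ ≡ ∣ X ∣
      ∣X∣+∣Q─Z∣≡∣X∣ = trans (cong (λ Y → ∣ X ∣ + ∣ Y ∣) (Empty-unique empty))
                            (trans (cong (∣ X ∣ +_) (∣⊥∣≡0 n)) (+-identityʳ ∣ X ∣))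
    separates-extend edge zero Z⊆Q ∣Q─Z∣≤0 X⊆P sep | yes (u , u∈Q─Z) =
      ⊥-elim (<⇒≢ (≤-trans (x∈p⇒0<∣p∣ u∈Q─Z) ∣Q─Z∣≤0) refl)
    separates-extend {Q = Q} {Z = Z} {X = X} edge (suc m) Z⊆Q ∣Q─Z∣≤1+m X⊆P sep | yes (u , u∈Q─Z)
      with separates-addLabel (edge u (p─q⊆p Q Z u∈Q─Z)) (x∈p─q⇒x∉q u∈Q─Z) Z⊆Q X⊆P sep
    ... | X₁ , X₁⊆P , sep₁ , ∣X∣<∣X₁∣
      with separates-extend edge m (∪⁅⁆⊆ Z⊆Q (p─q⊆p Q Z u∈Q─Z))
             (≤-pred (≤-trans (x∈p─q⇒∣p─[q∪⁅x⁆]∣<∣p─q∣ u∈Q─Z) ∣Q─Z∣≤1+m)) X₁⊆P sep₁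
    ... | X′ , X′⊆P , sep′ , ∣X₁∣+∣Q─Z₁∣≤∣X′∣ = X′ , X′⊆P , sep′ , (begin
      ∣ X ∣ + ∣ Q ─ Z ∣                  ≤⟨ +-monoʳ-≤ ∣ X ∣ (∣p─q∣≤1+∣p─[q∪⁅x⁆]∣ Q Z u) ⟩
      ∣ X ∣ + suc ∣ Q ─ (Z ∪ ⁅ u ⁆) ∣    ≡⟨ +-suc ∣ X ∣ ∣ Q ─ (Z ∪ ⁅ u ⁆) ∣ ⟩
      suc ∣ X ∣ + ∣ Q ─ (Z ∪ ⁅ u ⁆) ∣    ≤⟨ +-monoˡ-≤ ∣ Q ─ (Z ∪ ⁅ u ⁆) ∣ ∣X∣<∣X₁∣ ⟩
      ∣ X₁ ∣ + ∣ Q ─ (Z ∪ ⁅ u ⁆) ∣       ≤⟨ ∣X₁∣+∣Q─Z₁∣≤∣X′∣ ⟩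
      ∣ X′ ∣                              ∎)
      where open ≤-Reasoning

    labeledEdges⇒∣Q∣<∣P∣ : (∀ u → u ∈ Q → LabeledEdgeIn Q P u) → c ∈ P → ∣ Q ∣ < ∣ P ∣
    labeledEdges⇒∣Q∣<∣P∣ {Q = Q} {P = P} {c = c} edge c∈P
      with separates-extend edge ∣ Q ─ ∅ ∣ ⊥⊆ ≤-refl (x∈p⇒⁅x⁆⊆p c∈P) (separates-⁅⁆ {Z = ∅})
    ... | X′ , X′⊆P , _ , ∣⁅c⁆∣+∣Q─∅∣≤∣X′∣ = begin
      suc ∣ Q ∣            ≡⟨ cong₂ (λ k Y → k + ∣ Y ∣) (sym (∣⁅x⁆∣≡1 c)) (sym (p─⊥≡p Q)) ⟩
      ∣ ⁅ c ⁆ ∣ + ∣ Q ─ ∅ ∣ ≤⟨ ∣⁅c⁆∣+∣Q─∅∣≤∣X′∣ ⟩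
      ∣ X′ ∣               ≤⟨ p⊆q⇒∣p∣≤∣q∣ X′⊆P ⟩
      ∣ P ∣                ∎
      where open ≤-Reasoning

  CommonNeighbour : Graph n → Subset n → Fin n → Set
  CommonNeighbour G S x = ∀ z → z ∈ S → adj G x z ≡ true

  commonNeighbour? : ∀ G S x → Dec (CommonNeighbour G S x)
  commonNeighbour? G S x = all? (λ z → z ∈? S →-dec adj G x z ≟ᵇ true)

  commonNeighbour-∉ : ∀ G → CommonNeighbour G S x → x ∉ S
  commonNeighbour-∉ {x = x} G x-cn x∈S with trans (sym (x-cn x x∈S)) (irrefl G x)
  ... | ()

  module Complement (G : Graph n) where

    open Traces G using (distinguishing-⊆)

    adj-complement : x ≢ y → adj (complement G) x y ≡ not (adj G x y)
    adj-complement {x = x} {y = y} x≢y with x ≟ y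
    ... | yes x≡y = ⊥-elim (x≢y x≡y)
    ... | no  _   = ∧-identityʳ (not (adj G x y))

    sameTrace-complement : x ∉ S → y ∉ S → SameTrace G S x y → SameTrace (complement G) S x y
    sameTrace-complement {x = x} {y = y} x∉S y∉S x~y z z∈S = begin
      adj (complement G) x z  ≡⟨ adj-complement (x∉p∧y∈p⇒x≢y x∉S z∈S) ⟩
      not (adj G x z)         ≡⟨ cong not (x~y z z∈S) ⟩
      not (adj G y z)         ≡⟨ sym (adj-complement (x∉p∧y∈p⇒x≢y y∉S z∈S)) ⟩
      adj (complement G) y z  ∎
      where open ≡-Reasoning

    sameTrace-uncomplement : x ∉ S → y ∉ S → SameTrace (complement G) S x y → SameTrace G S x y
    sameTrace-uncomplement {x = x} {y = y} x∉S y∉S x~y z z∈S = not-injective (begin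
      not (adj G x z)         ≡⟨ sym (adj-complement (x∉p∧y∈p⇒x≢y x∉S z∈S)) ⟩
      adj (complement G) x z  ≡⟨ x~y z z∈S ⟩
      adj (complement G) y z  ≡⟨ adj-complement (x∉p∧y∈p⇒x≢y y∉S z∈S) ⟩
      not (adj G y z)         ∎)
      where open ≡-Reasoning

    distinguishing-complement : Distinguishing G S → Distinguishing (complement G) S
    distinguishing-complement dist x y x∉S y∉S x≢y x~y =
      dist x y x∉S y∉S x≢y (sameTrace-uncomplement x∉S y∉S x~y)

    distinguishing-uncomplement : Distinguishing (complement G) S → Distinguishing G S
    distinguishing-uncomplement dist x y x∉S y∉S x≢y x~y =
      dist x y x∉S y∉S x≢y (sameTrace-complement x∉S y∉S x~y)

    dominated-complement : x ∉ S → ¬ CommonNeighbour G S x →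
                           ∃ λ z → z ∈ S × adj (complement G) x z ≡ true
    dominated-complement {x = x} {S = S} x∉S ¬x-cn
      with ¬∀⟶∃¬ n _ (λ z → z ∈? S →-dec adj G x z ≟ᵇ true) ¬x-cn
    ... | z , ¬[z∈S⇒xz] with z ∈? S
    ...   | no  z∉S = ⊥-elim (¬[z∈S⇒xz] (λ z∈S → ⊥-elim (z∉S z∈S)))
    ...   | yes z∈S = z , z∈S , trans (adj-complement (x∉p∧y∈p⇒x≢y x∉S z∈S))
                                        (cong not (¬-not (λ xz → ¬[z∈S⇒xz] (λ _ → xz))))

    dominating-complement⇒¬commonNeighbour : Dominating (complement G) S → ¬ CommonNeighbour G S x
    dominating-complement⇒¬commonNeighbour {x = x} dom x-cn with dom x (commonNeighbour-∉ G x-cn)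
    ... | z , z∈S , xz
      with trans (sym xz) (trans (adj-complement (x∉p∧y∈p⇒x≢y (commonNeighbour-∉ G x-cn) z∈S))
                                 (cong not (x-cn z z∈S)))
    ...   | ()

    ldSet-complement : Distinguishing G S → (∀ x → ¬ CommonNeighbour G S x) → IsLDSet (complement G) S
    ldSet-complement dist none =
      distinguishing-complement dist , λ x x∉S → dominated-complement x∉S (none x)

    λ̄≤λ+1 : IsLocDomNumber G k → IsLocDomNumber (complement G) l → l ≤ k + 1
    λ̄≤λ+1 {k = k} ((S , (dist , _) , ∣S∣≡k) , _) (_ , minimal) with any? (commonNeighbour? G S)
    ... | no none = begin
      _      ≤⟨ minimal S (ldSet-complement dist (λ x x-cn → none (x , x-cn))) ⟩
      ∣ S ∣  ≡⟨ ∣S∣≡k ⟩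
      k      ≤⟨ m≤m+n k 1 ⟩
      k + 1  ∎
      where open ≤-Reasoning
    ... | yes (x , x-cn) = begin
      _                ≤⟨ minimal (S ∪ ⁅ x ⁆) (dist′ , dom) ⟩
      ∣ S ∪ ⁅ x ⁆ ∣    ≤⟨ ∣p∪q∣≤∣p∣+∣q∣ S ⁅ x ⁆ ⟩
      ∣ S ∣ + ∣ ⁅ x ⁆ ∣ ≡⟨ cong₂ _+_ ∣S∣≡k (∣⁅x⁆∣≡1 x) ⟩
      k + 1            ∎
      where
      open ≤-Reasoning
      dist′ : Distinguishing (complement G) (S ∪ ⁅ x ⁆)
      dist′ = distinguishing-complement (distinguishing-⊆ (p⊆p∪q ⁅ x ⁆) dist)
      dom : Dominating (complement G) (S ∪ ⁅ x ⁆)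
      dom y y∉S∪⁅x⁆ with dominated-complement y∉S ¬y-cn
        where
        y∉S : y ∉ S
        y∉S y∈S = y∉S∪⁅x⁆ (p⊆p∪q ⁅ x ⁆ y∈S)
        ¬y-cn : ¬ CommonNeighbour G S y
        ¬y-cn y-cn = dist x y (commonNeighbour-∉ G x-cn) y∉S
          (λ { refl → y∉S∪⁅x⁆ (x∈p∪q⁺ (inj₂ (x∈⁅x⁆ y))) })
          (λ z z∈S → trans (x-cn z z∈S) (sym (y-cn z z∈S)))
      ... | z , z∈S , yz = z , p⊆p∪q ⁅ x ⁆ z∈S , yz

    commonNeighbour-of-distinguishing : IsLocDomNumber (complement G) l → Distinguishing G S →
                                        ∣ S ∣ < l → ∃ (CommonNeighbour G S)
    commonNeighbour-of-distinguishing {S = S} (_ , minimal) dist ∣S∣<l with any? (commonNeighbour? G S)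
    ... | yes cn  = cn
    ... | no none = ⊥-elim (<⇒≱ ∣S∣<l (minimal S (ldSet-complement dist (λ x x-cn → none (x , x-cn)))))

  TwinFreeOutside : Graph n → Subset n → Set
  TwinFreeOutside G Y = ∀ x y → x ∉ Y → y ∉ Y → ¬ Twins G x y

  connected⇒neighbour : ∀ {G} → Connected G → x ≢ y → ∃ λ z → adj G x z ≡ true
  connected⇒neighbour {x = x} {y = y} conn x≢y with conn x y
  ... | here          = ⊥-elim (x≢y refl)
  ... | step {y = z} xz _ = z , xz

  record Bipartition (G : Graph n) (Y : Subset n) : Set where
    field
      inside-stable  : Stable G Y
      outside-stable : ∀ x y → x ∉ Y → y ∉ Y → adj G x y ≡ false

  bipartition-∁ : ∀ {G Y} → Bipartition G Y → Bipartition G (∁ Y)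
  bipartition-∁ bip = record
    { inside-stable  = λ x y x∈∁Y y∈∁Y → outside-stable x y (x∈∁p⇒x∉p x∈∁Y) (x∈∁p⇒x∉p y∈∁Y)
    ; outside-stable = λ x y x∉∁Y y∉∁Y → inside-stable x y (x∉∁p⇒x∈p x∉∁Y) (x∉∁p⇒x∈p y∉∁Y)
    }
    where open Bipartition bip

  module Bipartite {G : Graph n} {Y : Subset n} (bip : Bipartition G Y) where

    open Bipartition bip
    open Traces G
    open Complement G using (commonNeighbour-of-distinguishing)

    adj-inside : y ∈ Y → adj G y x ≡ true → x ∉ Y
    adj-inside {y = y} {x = x} y∈Y yx x∈Y with trans (sym yx) (inside-stable y x y∈Y x∈Y)
    ... | ()

    adj-outside : x ∉ Y → adj G x y ≡ true → y ∈ Y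
    adj-outside {x = x} {y = y} x∉Y xy with y ∈? Y
    ... | yes y∈Y = y∈Y
    ... | no  y∉Y with trans (sym xy) (outside-stable x y x∉Y y∉Y)
    ...   | ()

    neighbour-inside : Connected G → y ∈ Y → x ∉ Y → ∃ λ z → z ∈ Y × adj G x z ≡ true
    neighbour-inside conn y∈Y x∉Y with connected⇒neighbour conn (x∉p∧y∈p⇒x≢y x∉Y y∈Y)
    ... | z , xz = z , adj-outside x∉Y xz , xz

    adj-outside-equal : x ∉ Y → y ∉ Y → z ∉ Y → adj G x z ≡ adj G y z
    adj-outside-equal {x = x} {y = y} {z = z} x∉Y y∉Y z∉Y =
      trans (outside-stable x z x∉Y z∉Y) (sym (outside-stable y z y∉Y z∉Y))

    sameTrace⇒sameNeighbours : x ∉ Y → y ∉ Y → SameTrace G Y x y → ∀ z → adj G x z ≡ adj G y z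
    sameTrace⇒sameNeighbours x∉Y y∉Y x~y z with z ∈? Y
    ... | yes z∈Y = x~y z z∈Y
    ... | no  z∉Y = adj-outside-equal x∉Y y∉Y z∉Y

    sameTrace-∩ : x ∉ Y → y ∉ Y → SameTrace G (Y ∩ S) x y → SameTrace G S x y
    sameTrace-∩ x∉Y y∉Y x~y z z∈S with z ∈? Y
    ... | yes z∈Y = x~y z (x∈p∩q⁺ (z∈Y , z∈S))
    ... | no  z∉Y = adj-outside-equal x∉Y y∉Y z∉Y

    distinguishing⇒twinFree : Distinguishing G Y → TwinFreeOutside G Y
    distinguishing⇒twinFree dist x y x∉Y y∉Y (x≢y , inj₁ same) = dist x y x∉Y y∉Y x≢y (λ z _ → same z)
    distinguishing⇒twinFree dist x y x∉Y y∉Y (x≢y , inj₂ sameClosed)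
      with trans (sym closedAdj-x-x) (trans (sameClosed x) closedAdj-y-x)
      where
      closedAdj-x-x : closedAdj G x x ≡ true
      closedAdj-x-x with x ≟ x
      ... | yes _   = ∨-zeroʳ (adj G x x)
      ... | no  x≢x = ⊥-elim (x≢x refl)
      closedAdj-y-x : closedAdj G y x ≡ false
      closedAdj-y-x with y ≟ x
      ... | yes y≡x = ⊥-elim (x≢y (sym y≡x))
      ... | no  _   = trans (∨-identityʳ (adj G y x)) (outside-stable y x y∉Y x∉Y)
    ... | ()

    twinFree⇒distinguishing : TwinFreeOutside G Y → Distinguishing G Y
    twinFree⇒distinguishing tf x y x∉Y y∉Y x≢y x~y =
      tf x y x∉Y y∉Y (x≢y , inj₁ (sameTrace⇒sameNeighbours x∉Y y∉Y x~y))

    labeledEdge-unique : TwinFreeOutside G Y → LabeledEdge G Y u a b → LabeledEdge G Y u a c → b ≡ c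
    labeledEdge-unique {u = u} {b = b} {c = c} tf (_ , b∉Y , _ , a≁b , a~b) (_ , c∉Y , _ , a≁c , a~c)
      with b ≟ c
    ... | yes b≡c = b≡c
    ... | no  b≢c = ⊥-elim (tf b c b∉Y c∉Y (b≢c , inj₁ (sameTrace⇒sameNeighbours b∉Y c∉Y b~c)))
      where
      b~c : SameTrace G Y b c
      b~c z z∈Y with z ≟ u
      ... | yes refl = not-injective (trans (sym (¬-not a≁b)) (¬-not a≁c))
      ... | no  z≢u  = trans (sym (a~b z z∈Y z≢u)) (a~c z z∈Y z≢u)

    labeledEdges-disjoint : TwinFreeOutside G Y → LabeledEdge G Y u a b → LabeledEdge G Y u c d →
                            ¬ ((a ≡ c × b ≡ d) ⊎ (a ≡ d × b ≡ c)) → x ≡ a ⊎ x ≡ b → y ≡ c ⊎ y ≡ d → x ≢ y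
    labeledEdges-disjoint tf e e′ e≠e′ (inj₁ refl) (inj₁ refl) refl =
      e≠e′ (inj₁ (refl , labeledEdge-unique tf e e′))
    labeledEdges-disjoint tf e e′ e≠e′ (inj₁ refl) (inj₂ refl) refl =
      e≠e′ (inj₂ (refl , labeledEdge-unique tf e (labeledEdge-sym e′)))
    labeledEdges-disjoint tf e e′ e≠e′ (inj₂ refl) (inj₁ refl) refl =
      e≠e′ (inj₂ (labeledEdge-unique tf (labeledEdge-sym e) e′ , refl))
    labeledEdges-disjoint tf e e′ e≠e′ (inj₂ refl) (inj₂ refl) refl =
      e≠e′ (inj₁ (labeledEdge-unique tf (labeledEdge-sym e) (labeledEdge-sym e′) , refl))

    dominating-commonNeighbour⇒≡ : Dominating G S → CommonNeighbour G S x → x ∉ Y → S ≡ Y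
    dominating-commonNeighbour⇒≡ {S = S} dom x-cn x∉Y = ⊆-antisym S⊆Y Y⊆S
      where
      S⊆Y : S ⊆ Y
      S⊆Y {z} z∈S = adj-outside x∉Y (x-cn z z∈S)
      Y⊆S : Y ⊆ S
      Y⊆S {y} y∈Y with y ∈? S
      ... | yes y∈S = y∈S
      ... | no  y∉S with dom y y∉S
      ...   | z , z∈S , yz = ⊥-elim (adj-inside y∈Y yz (S⊆Y z∈S))

    -- Trading y ∈ Y for a neighbour w ∉ Y keeps Y distinguishing unless G^Y has an edge labelled
    -- y avoiding w, and leaves no common neighbour, since a vertex adjacent to w lies in Y.
    module Swap {y w : Fin n} (y∈Y : y ∈ Y) (w∉Y : w ∉ Y) where

      T : Subset n
      T = (Y - y) ∪ ⁅ w ⁆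

      w∈T : w ∈ T
      w∈T = x∈p∪q⁺ (inj₂ (x∈⁅x⁆ w))

      ∈T : v ∈ Y → v ≢ y → v ∈ T
      ∈T v∈Y v≢y = p⊆p∪q ⁅ w ⁆ (x∈p∧x≢y⇒x∈p-y v∈Y v≢y)

      ∉T⇒≢w : v ∉ T → v ≢ w
      ∉T⇒≢w v∉T refl = v∉T w∈T

      ∉T⇒≡y : v ∈ Y → v ∉ T → v ≡ y
      ∉T⇒≡y {v = v} v∈Y v∉T with v ≟ y
      ... | yes v≡y = v≡y
      ... | no  v≢y = ⊥-elim (v∉T (∈T v∈Y v≢y))

      ∣T∣≤∣Y∣ : ∣ T ∣ ≤ ∣ Y ∣
      ∣T∣≤∣Y∣ = begin
        ∣ T ∣                   ≤⟨ ∣p∪q∣≤∣p∣+∣q∣ (Y - y) ⁅ w ⁆ ⟩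
        ∣ Y - y ∣ + ∣ ⁅ w ⁆ ∣   ≡⟨ trans (cong (∣ Y - y ∣ +_) (∣⁅x⁆∣≡1 w)) (+-comm ∣ Y - y ∣ 1) ⟩
        suc ∣ Y - y ∣           ≤⟨ x∈p⇒∣p-x∣<∣p∣ y∈Y ⟩
        ∣ Y ∣                   ∎
        where open ≤-Reasoning

      ∉T-sameTrace⇒≡ : adj G w y ≡ true → a ∈ Y → a ∉ T → b ∉ T → SameTrace G T a b → a ≡ b
      ∉T-sameTrace⇒≡ {a = a} {b = b} wy a∈Y a∉T b∉T a~b = trans a≡y (sym (∉T⇒≡y b∈Y b∉T))
        where
        a≡y : a ≡ y
        a≡y = ∉T⇒≡y a∈Y a∉T
        b∈Y : b ∈ Y
        b∈Y = adj-outside w∉Y (begin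
          adj G w b  ≡⟨ Graph.sym G w b ⟩
          adj G b w  ≡⟨ sym (a~b w w∈T) ⟩
          adj G a w  ≡⟨ cong (λ v → adj G v w) a≡y ⟩
          adj G y w  ≡⟨ Graph.sym G y w ⟩
          adj G w y  ≡⟨ wy ⟩
          true       ∎)
          where open ≡-Reasoning

      distinguishing : adj G w y ≡ true → Distinguishing G Y →
                       (∀ a b → LabeledEdge G Y y a b → a ≢ w → b ≢ w → ⊥) → Distinguishing G T
      distinguishing wy dist noEdge p q p∉T q∉T p≢q p~q with p ∈? Y | q ∈? Y
      ... | yes p∈Y | _       = p≢q (∉T-sameTrace⇒≡ wy p∈Y p∉T q∉T p~q)
      ... | no  _   | yes q∈Y = p≢q (sym (∉T-sameTrace⇒≡ wy q∈Y q∉T p∉T (sameTrace-sym p~q)))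
      ... | no  p∉Y | no  q∉Y with adj G p y ≟ᵇ adj G q y
      ...   | no  p≁q = noEdge p q (p∉Y , q∉Y , y∈Y , p≁q , λ v v∈Y v≢y → p~q v (∈T v∈Y v≢y))
                               (∉T⇒≢w p∉T) (∉T⇒≢w q∉T)
      ...   | yes p≈q = dist p q p∉Y q∉Y p≢q p~q-on-Y
        where
        p~q-on-Y : SameTrace G Y p q
        p~q-on-Y z z∈Y with z ≟ y
        ... | yes refl = p≈q
        ... | no  z≢y  = p~q z (∈T z∈Y z≢y)

      ¬commonNeighbour : y′ ∈ Y → y′ ≢ y → ¬ CommonNeighbour G T x
      ¬commonNeighbour {y′ = y′} {x = x} y′∈Y y′≢y x-cn =
        adj-inside (adj-outside w∉Y (trans (Graph.sym G w x) (x-cn w w∈T))) (x-cn y′ (∈T y′∈Y y′≢y)) y′∈Y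

    labeledEdge-avoiding : IsLocDomNumber (complement G) l → Distinguishing G Y → ∣ Y ∣ < l → 1 < ∣ Y ∣ →
                           y ∈ Y → w ∉ Y → adj G w y ≡ true →
                           ∃₂ λ a b → LabeledEdge G Y y a b × a ≢ w × b ≢ w
    labeledEdge-avoiding {y = y} {w = w} λ̄ dist ∣Y∣<l 1<∣Y∣ y∈Y w∉Y wy
      with any? (λ a → any? (λ b → labeledEdge? Y y a b ×-dec ¬? (a ≟ w) ×-dec ¬? (b ≟ w)))
    ... | yes edge = edge
    ... | no  none
      with commonNeighbour-of-distinguishing λ̄
             (Swap.distinguishing y∈Y w∉Y wy dist (λ a b e a≢w b≢w → none (a , b , e , a≢w , b≢w)))
             (≤-<-trans (Swap.∣T∣≤∣Y∣ y∈Y w∉Y) ∣Y∣<l)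
    ...   | x , x-cn with 1<∣p∣⇒Nonempty[p-x] {x = y} 1<∣Y∣
    ...     | y′ , y′∈Y-y =
      ⊥-elim (Swap.¬commonNeighbour y∈Y w∉Y (p─q⊆p Y ⁅ y ⁆ y′∈Y-y) (x∈p-y⇒x≢y y′∈Y-y) x-cn)

    neighbour-outside : Connected G → x ∉ Y → y ∈ Y → ∃ λ z → z ∉ Y × adj G y z ≡ true
    neighbour-outside conn x∉Y y∈Y with connected⇒neighbour conn (x∉p∧y∈p⇒x≢y x∉Y y∈Y ∘ sym)
    ... | z , yz = z , adj-inside y∈Y yz , yz

    distinguishing⇒∣Y∣<∣∁Y∣ : Connected G → IsLocDomNumber (complement G) l → Distinguishing G Y →
                              ∣ Y ∣ < l → 1 < ∣ Y ∣ → x ∉ Y → ∣ Y ∣ < ∣ ∁ Y ∣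
    distinguishing⇒∣Y∣<∣∁Y∣ conn λ̄ dist ∣Y∣<l 1<∣Y∣ x∉Y = labeledEdges⇒∣Q∣<∣P∣ edge (x∉p⇒x∈∁p x∉Y)
      where
      edge : ∀ y → y ∈ Y → LabeledEdgeIn Y (∁ Y) y
      edge y y∈Y with neighbour-outside conn x∉Y y∈Y
      ... | w , w∉Y , yw
        with labeledEdge-avoiding λ̄ dist ∣Y∣<l 1<∣Y∣ y∈Y w∉Y (trans (Graph.sym G w y) yw)
      ...   | a , b , e@(a∉Y , b∉Y , _) , _ = a , b , x∉p⇒x∈∁p a∉Y , x∉p⇒x∈∁p b∉Y , e

    module _ (tf : TwinFreeOutside G Y) (two : ∀ u → u ∈ Y → TwoEdgesWithLabel G Y u) where

      -- The two edges labelled u are disjoint by twin-freeness, and X misses an end of each.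
      separates[Y-u]-bound : u ∈ Y → X ⊆ ∁ Y → Separates (Y - u) X → ∣ X ∣ + 2 ≤ ∣ ∁ Y ∣
      separates[Y-u]-bound u∈Y X⊆∁Y sep with two _ u∈Y
      ... | a , b , c , d , e , e′ , e≠e′
        with separates-missesEndpoint sep e | separates-missesEndpoint sep e′
      ...   | x , x∈ab , x∉X | y , y∈cd , y∉X =
        ∣p∣+2≤∣q∣ X⊆∁Y (endpoint∈∁Y e x∈ab) (endpoint∈∁Y e′ y∈cd) x∉X y∉X
                  (labeledEdges-disjoint tf e e′ e≠e′ x∈ab y∈cd)
        where
        endpoint∈∁Y : ∀ {u a b x} → LabeledEdge G Y u a b → x ≡ a ⊎ x ≡ b → x ∈ ∁ Y
        endpoint∈∁Y (a∉Y , _)       (inj₁ refl) = x∉p⇒x∈∁p a∉Y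
        endpoint∈∁Y (_ , b∉Y , _)   (inj₂ refl) = x∉p⇒x∈∁p b∉Y

      -- If u₁ ∈ Y ─ S, extending the (Y ∩ S)-separated set ∁Y ─ S by the labels of (Y - u₁) ─ S
      -- forces |Y ─ S| + |∁Y ─ S| < |∁Y|, while n ≤ |S| + |Y ─ S| + |∁Y ─ S| and |S| ≤ |Y|.
      Y⊆smallDistinguishing : Distinguishing G S → ∣ S ∣ ≤ ∣ Y ∣ → Y ⊆ S
      Y⊆smallDistinguishing {S = S} dist ∣S∣≤∣Y∣ {u₁} u₁∈Y with u₁ ∈? S
      ... | yes u₁∈S = u₁∈S
      ... | no  u₁∉S
        with separates-extend edges ∣ (Y - u₁) ─ (Y ∩ S) ∣ Y∩S⊆Y-u₁ ≤-refl (p─q⊆p (∁ Y) S) separates-∁Y─S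
        where
        edges : ∀ u → u ∈ Y - u₁ → LabeledEdgeIn (Y - u₁) (∁ Y) u
        edges u u∈Y-u₁ with two u (p─q⊆p Y ⁅ u₁ ⁆ u∈Y-u₁)
        ... | a , b , _ , _ , e@(a∉Y , b∉Y , _) , _ =
          a , b , x∉p⇒x∈∁p a∉Y , x∉p⇒x∈∁p b∉Y , labeledEdge-⊆ (p─q⊆p Y ⁅ u₁ ⁆) u∈Y-u₁ e
        Y∩S⊆Y-u₁ : Y ∩ S ⊆ Y - u₁
        Y∩S⊆Y-u₁ z∈Y∩S with x∈p∩q⁻ Y S z∈Y∩S
        ... | z∈Y , z∈S = x∈p∧x≢y⇒x∈p-y z∈Y (λ { refl → u₁∉S z∈S })
        separates-∁Y─S : Separates (Y ∩ S) (∁ Y ─ S)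
        separates-∁Y─S a b a∈ b∈ a≢b a~b =
          dist a b (x∈p─q⇒x∉q a∈) (x∈p─q⇒x∉q b∈) a≢b
               (sameTrace-∩ (x∈∁p⇒x∉p (p─q⊆p (∁ Y) S a∈)) (x∈∁p⇒x∉p (p─q⊆p (∁ Y) S b∈)) a~b)
      ...   | X′ , X′⊆∁Y , sep′ , ∣∁Y─S∣+∣Q─Z∣≤∣X′∣ = ⊥-elim (<-irrefl refl (begin-strict
        ∣ ∁ Y ∣                      ≤⟨ +-cancelˡ-≤ ∣ Y ∣ _ _ ∣Y∣+∣∁Y∣≤∣Y∣+∣Y─S∣+∣∁Y─S∣ ⟩
        ∣ Y ─ S ∣ + ∣ ∁ Y ─ S ∣      ≤⟨ +-monoˡ-≤ ∣ ∁ Y ─ S ∣ (∣p─q∣≤1+∣[p-x]─[p∩q]∣ Y S u₁) ⟩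
        suc (∣ Q─Z ∣ + ∣ ∁ Y ─ S ∣)  ≡⟨ cong suc (+-comm ∣ Q─Z ∣ ∣ ∁ Y ─ S ∣) ⟩
        suc (∣ ∁ Y ─ S ∣ + ∣ Q─Z ∣)  ≤⟨ s≤s ∣∁Y─S∣+∣Q─Z∣≤∣X′∣ ⟩
        suc ∣ X′ ∣                   <⟨ ≤-reflexive (+-comm 2 ∣ X′ ∣) ⟩
        ∣ X′ ∣ + 2                   ≤⟨ separates[Y-u]-bound u₁∈Y X′⊆∁Y sep′ ⟩
        ∣ ∁ Y ∣                      ∎))
        where
        open ≤-Reasoning
        Q─Z : Subset n
        Q─Z = (Y - u₁) ─ (Y ∩ S)
        ∣Y∣+∣∁Y∣≤∣Y∣+∣Y─S∣+∣∁Y─S∣ : ∣ Y ∣ + ∣ ∁ Y ∣ ≤ ∣ Y ∣ + (∣ Y ─ S ∣ + ∣ ∁ Y ─ S ∣)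
        ∣Y∣+∣∁Y∣≤∣Y∣+∣Y─S∣+∣∁Y─S∣ = begin
          ∣ Y ∣ + ∣ ∁ Y ∣                     ≡⟨ ∣p∣+∣∁p∣≡n Y ⟩
          n                                   ≤⟨ n≤∣p∣+∣q─p∣+∣∁q─p∣ S Y ⟩
          ∣ S ∣ + (∣ Y ─ S ∣ + ∣ ∁ Y ─ S ∣)   ≤⟨ +-monoˡ-≤ _ ∣S∣≤∣Y∣ ⟩
          ∣ Y ∣ + (∣ Y ─ S ∣ + ∣ ∁ Y ─ S ∣)   ∎

      smallDistinguishing⊆Y : Distinguishing G S → ∣ S ∣ ≤ ∣ Y ∣ → S ⊆ Y
      smallDistinguishing⊆Y {S = S} dist ∣S∣≤∣Y∣ {b} b∈S with b ∈? Y
      ... | yes b∈Y = b∈Y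
      ... | no  b∉Y = ⊥-elim (<⇒≱ (x∉p⇒∣p∣<∣p∪⁅x⁆∣ b∉Y) (≤-trans (p⊆q⇒∣p∣≤∣q∣ Y∪⁅b⁆⊆S) ∣S∣≤∣Y∣))
        where
        Y∪⁅b⁆⊆S : Y ∪ ⁅ b ⁆ ⊆ S
        Y∪⁅b⁆⊆S = ∪⁅⁆⊆ (Y⊆smallDistinguishing dist ∣S∣≤∣Y∣) b∈S

  Conditions : Graph n → Subset n → Set
  Conditions G U =
    TwinFreeOutside G U ×
    (∃ λ w → w ∉ U × (∀ u → (adj G w u ≡ true ⇔ u ∈ U))) ×
    (∀ u → u ∈ U → TwoEdgesWithLabel G U u)

  module _ {G : Graph n} {U : Subset n} (bip : Bipartition G U) (conn : Connected G) where

    open Traces G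
    open Complement G
    open Bipartite bip
    private
      module W = Bipartite (bipartition-∁ bip)

    conditions-of-commonNeighbour : IsLocDomNumber (complement G) l → Distinguishing G U → ∣ U ∣ < l →
                                    1 < ∣ U ∣ → x ∉ U → CommonNeighbour G U x → Conditions G U
    conditions-of-commonNeighbour {x = x} λ̄ dist ∣U∣<l 1<∣U∣ x∉U x-cn =
      distinguishing⇒twinFree dist ,
      (x , x∉U , λ u → mk⇔ (adj-outside x∉U) (x-cn u)) ,
      λ u u∈U → twoEdgesWithLabel (labeledEdge-avoiding λ̄ dist ∣U∣<l 1<∣U∣ u∈U) x∉U (x-cn u u∈U)

    λ<λ̄⇒conditions : 1 < ∣ U ∣ → ∣ U ∣ < ∣ ∁ U ∣ → IsLocDomNumber G k →
                      IsLocDomNumber (complement G) l → k < l → Conditions G U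
    λ<λ̄⇒conditions 1<∣U∣ ∣U∣<∣∁U∣ ((S , (dist , dom) , refl) , _) λ̄ ∣S∣<l
      with commonNeighbour-of-distinguishing λ̄ dist ∣S∣<l
    ... | x , x-cn with x ∈? U
    ...   | no  x∉U with refl ← dominating-commonNeighbour⇒≡ dom x-cn x∉U =
      conditions-of-commonNeighbour λ̄ dist ∣S∣<l 1<∣U∣ x∉U x-cn
    ...   | yes x∈U with refl ← W.dominating-commonNeighbour⇒≡ dom x-cn (x∈p⇒x∉∁p x∈U) =
      ⊥-elim (<-asym ∣U∣<∣∁U∣ (subst (∣ ∁ U ∣ <_) (cong ∣_∣ (∁∁p≡p U))
        (W.distinguishing⇒∣Y∣<∣∁Y∣ conn λ̄ dist ∣S∣<l (<-trans 1<∣U∣ ∣U∣<∣∁U∣) (x∈p⇒x∉∁p x∈U))))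

    conditions⇒λ<λ̄ : 0 < ∣ U ∣ → IsLocDomNumber G k → IsLocDomNumber (complement G) l →
                      Conditions G U → k < l
    conditions⇒λ<λ̄ {k = k} 0<∣U∣ (_ , minimal) ((T , (distT̄ , domT̄) , refl) , _)
                   (tf , (w , _ , N[w]≡U) , two)
      with k <? ∣ T ∣
    ... | yes k<l = k<l
    ... | no  k≮l = ⊥-elim (dominating-complement⇒¬commonNeighbour domT̄ w-cn)
      where
      U-isLDSet : IsLDSet G U
      U-isLDSet = twinFree⇒distinguishing tf ,
                  λ x x∉U → neighbour-inside conn (proj₂ (0<∣p∣⇒Nonempty 0<∣U∣)) x∉U
      T⊆U : T ⊆ U
      T⊆U = smallDistinguishing⊆Y tf two (distinguishing-uncomplement distT̄)
                                  (≤-trans (≮⇒≥ k≮l) (minimal U U-isLDSet))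
      w-cn : CommonNeighbour G T w
      w-cn z z∈T = Equivalence.from (N[w]≡U z) (T⊆U z∈T)

theorem17 : (n r s : ℕ) → (G : Graph n) → (U : Subset n) →
  Connected G → Stable G U → Stable G (∁ U) →
  ∣ U ∣ ≡ r → ∣ ∁ U ∣ ≡ s → n ≡ r + s → 4 ≤ n → 3 ≤ r → r < s →
  (k l : ℕ) → IsLocDomNumber G k → IsLocDomNumber (complement G) l →
  (l ≡ k + 1 ⇔
    ((∀ x y → x ∉ U → y ∉ U → ¬ Twins G x y)
     × (∃ λ w → w ∉ U × (∀ u → (adj G w u ≡ true ⇔ u ∈ U)))
     × (∀ u → u ∈ U → TwoEdgesWithLabel G U u)))
theorem17 n _ _ G U conn stable-U stable-∁U refl refl _ _ 3≤∣U∣ ∣U∣<∣∁U∣ k l λG λ̄ =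
  mk⇔ (λ l≡k+1 → λ<λ̄⇒conditions bip conn 1<∣U∣ ∣U∣<∣∁U∣ λG λ̄ (k<l l≡k+1))
      (λ conditions → ≤-antisym (λ̄≤λ+1 λG λ̄) (k+1≤l (conditions⇒λ<λ̄ bip conn 0<∣U∣ λG λ̄ conditions)))
  where
  open Complement G using (λ̄≤λ+1)
  bip : Bipartition G U
  bip = record
    { inside-stable  = stable-U
    ; outside-stable = λ x y x∉U y∉U → stable-∁U x y (x∉p⇒x∈∁p x∉U) (x∉p⇒x∈∁p y∉U)
    }
  1<∣U∣ : 1 < ∣ U ∣
  1<∣U∣ = ≤-trans (s≤s (s≤s z≤n)) 3≤∣U∣
  0<∣U∣ : 0 < ∣ U ∣
  0<∣U∣ = <-trans (s≤s z≤n) 1<∣U∣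
  k<l : l ≡ k + 1 → k < l
  k<l l≡k+1 = ≤-reflexive (trans (+-comm 1 k) (sym l≡k+1))
  k+1≤l : k < l → k + 1 ≤ l
  k+1≤l = subst (_≤ l) (+-comm 1 k)
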